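{- Let $M$ be a connected matroid on $[n]$, $\mathcal G$ a building set in its lattice of flats $\mathcal L_M$, and $\mathcal S$ a nested set of $\mathcal G$ with $[n]\notin\mathcal S$. Let $w=\sum_{G\in\mathcal S}\lambda_G v_G$ with all $\lambda_G>0$ and set $M_{\mathcal S}=M_w$ (this does not depend on the choice of the $\lambda_G$). For each $G\in\mathcal S\cup\{[n]\}$ let $G_{<}$ denote the join in $\mathcal L_M$ (the flat spanned by the union) of all elements of $\mathcal S$ strictly contained in $G$, with $G_<=\emptyset$ if there are none. Then $$M_{\mathcal S}=\bigoplus_{G\in\mathcal S\cup\{[n]\}} M[G_{<},G].$$
   Context: A matroid on $[n]$ is given by its bases; it is connected if any two elements lie in a common circuit. For $w\in\mathbb R^n$, $M_w$ is the matroid on $[n]$ whose bases are the bases $\tau$ of $M$ maximizing $\sum_{i\in\tau}w_i$. $v_G$ is the indicator vector of $G$. For flats $F\subseteq G$, $M[F,G]$ is the matroid on $G\setminus F$ obtained by restricting $M$ to $G$ and contracting $F$; the direct sum of matroids on disjoint ground sets has as bases the unions of bases of the summands. A building set in $\mathcal L_M$ is a set $\mathcal G$ of nonempty flats such that for every nonempty flat $X$, with $\{G_1,\dots,G_k\}$ the maximal elements of $\mathcal G$ contained in $X$, the map $\prod_j[\emptyset,G_j]\to[\emptyset,X]$, $(Y_j)\mapsto\bigvee_jY_j$, is a poset isomorphism (for connected $M$, $[n]\in\mathcal G$). A subset $\mathcal S\subseteq\mathcal G$ is nested if for any $t\ge2$ pairwise incomparable $X_1,\dots,X_t\in\mathcal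 S$ their join is not in $\mathcal G$.
   Formalization: The coefficients $\lambda_G$ are positive rationals, so the weight vector $w$ has rational entries. -}

module Defs where

open import Data.Bool using (Bool; true; false; _∨_; if_then_else_)
open import Data.Nat as ℕ using (ℕ; zero; suc; _⊔_)
open import Data.Fin using (Fin)
open import Data.Fin.Subset public
  using (Subset; _∈_; _∉_; _⊆_; _∪_; _∩_; _─_; _-_; ⁅_⁆; ⋃; ∣_∣; ⊤; ⊥)
open import Data.Fin.Subset.Properties using (_⊆?_; _∈?_)
open import Data.List using (List; []; _∷_; map; _++_; filter; foldr; length; allFin)
open import Data.List.Relation.Unary.Any using (Any; any?)
open import Data.List.Relation.Unary.All using (All)
open import Data.List.Relation.Unary.AllPairs using (AllPairs)
open import Data.List.Membership.Propositional public using () renaming (_∈_ to _∈ₗ_; _∉_ to _∉ₗ_)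
open import Data.Vec using (Vec; []; _∷_; tabulate)
import Data.Vec.Properties as VecP
import Data.Bool as B
open import Data.Rational as ℚ using (ℚ; 0ℚ)
open import Data.Product using (Σ; ∃; ∃-syntax; _×_; _,_)
open import Relation.Nullary using (¬_; Dec; yes; no; ⌊_⌋)
open import Relation.Nullary.Decidable using (_×-dec_; ¬?)
open import Relation.Binary.PropositionalEquality using (_≡_; _≢_)

record Matroid (n : ℕ) : Set where
  field
    bases    : List (Subset n)
    nonempty : ∃[ B ] (B ∈ₗ bases)
    exchange : ∀ {B₁ B₂} → B₁ ∈ₗ bases → B₂ ∈ₗ bases →
               ∀ {x} → x ∈ B₁ → x ∉ B₂ →
               ∃[ y ] (y ∈ B₂ × y ∉ B₁ × (((B₁ - x) ∪ ⁅ y ⁆) ∈ₗ bases))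

open Matroid public

subsets : (n : ℕ) → List (Subset n)
subsets zero = [] ∷ []
subsets (suc n) = map (true ∷_) (subsets n) ++ map (false ∷_) (subsets n)

_≟ˢ_ : ∀ {n} (X Y : Subset n) → Dec (X ≡ Y)
_≟ˢ_ = VecP.≡-dec B._≟_

module _ {n : ℕ} (M : Matroid n) where

  Indep : Subset n → Set
  Indep I = Any (λ B → I ⊆ B) (bases M)

  indep? : (I : Subset n) → Dec (Indep I)
  indep? I = any? (λ B → I ⊆? B) (bases M)

  Dependent : Subset n → Set
  Dependent X = ¬ Indep X

  Circuit : Subset n → Set
  Circuit C = Dependent C × (∀ Y → Y ⊆ C → Y ≢ C → Indep Y)

  Connected : Set
  Connected = ∀ (i j : Fin n) → i ≢ j → ∃[ C ] (Circuit C × i ∈ C × j ∈ C)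

  rank : Subset n → ℕ
  rank X = foldr _⊔_ 0
    (map ∣_∣ (filter (λ Y → (Y ⊆? X) ×-dec indep? Y) (subsets n)))

  cl : Subset n → Subset n
  cl X = tabulate (λ e → ⌊ rank (X ∪ ⁅ e ⁆) ℕ.≟ rank X ⌋)

  IsFlat : Subset n → Set
  IsFlat X = cl X ≡ X

  join : List (Subset n) → Subset n
  join Xs = cl (⋃ Xs)

  Nonempty : Subset n → Set
  Nonempty X = ∃[ i ] (i ∈ X)

  maxBelow : List (Subset n) → Subset n → List (Subset n)
  maxBelow 𝒢 X = filter (λ G → (G ⊆? X) ×-dec
                         ¬? (any? (λ H → (H ⊆? X) ×-dec ((G ⊆? H) ×-dec ¬? (G ≟ˢ H))) 𝒢))
                        𝒢

  IsBuildingSet : List (Subset n) → Set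
  IsBuildingSet 𝒢 =
    All (λ G → IsFlat G × Nonempty G) 𝒢 ×
    (∀ X → IsFlat X → Nonempty X →
      let Gs = maxBelow 𝒢 X
          k  = length Gs
          G  = Data.List.lookup Gs
          -- elements of the product ∏_j [∅, G_j] of intervals of flats
          InProd : (Fin k → Subset n) → Set
          InProd t = ∀ j → IsFlat (t j) × t j ⊆ G j
          φ : (Fin k → Subset n) → Subset n
          φ t = join (map t (allFin k))
      in
         (∀ t → InProd t → IsFlat (φ t) × φ t ⊆ X)
       × (∀ t t' → InProd t → InProd t' →
            ((∀ j → t j ⊆ t' j) → φ t ⊆ φ t') × (φ t ⊆ φ t' → ∀ j → t j ⊆ t' j))
       × (∀ Z → IsFlat Z → Z ⊆ X → ∃[ t ] (InProd t × φ t ≡ Z)))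

  Incomparable : Subset n → Subset n → Set
  Incomparable A B = ¬ A ⊆ B × ¬ B ⊆ A

  IsNested : List (Subset n) → List (Subset n) → Set
  IsNested 𝒢 𝒮 =
    All (_∈ₗ 𝒢) 𝒮 ×
    (∀ (Xs : List (Subset n)) → 2 ℕ.≤ length Xs → All (_∈ₗ 𝒮) Xs →
       AllPairs Incomparable Xs → join Xs ∉ₗ 𝒢)

  BasisOf : Subset n → Subset n → Set
  BasisOf X I = I ⊆ X × Indep I × (∀ J → I ⊆ J → J ⊆ X → Indep J → J ≡ I)

  -- B is a basis of the minor M[F,G] = (M|G)/F (ground set G ∖ F)
  MinorBasis : Subset n → Subset n → Subset n → Set
  MinorBasis F G B = B ⊆ (G ─ F) × ∃[ I ] (BasisOf F I × BasisOf G (B ∪ I))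

  -- bases of M_w : bases of M of maximal weight
  weight : (Fin n → ℚ) → Subset n → ℚ
  weight w τ = foldr ℚ._+_ 0ℚ
    (map (λ i → if ⌊ i ∈? τ ⌋ then w i else 0ℚ) (allFin n))

  BasisW : (Fin n → ℚ) → Subset n → Set
  BasisW w τ = τ ∈ₗ bases M × (∀ σ → σ ∈ₗ bases M → weight w σ ℚ.≤ weight w τ)

  strictlyBelow : List (Subset n) → Subset n → List (Subset n)
  strictlyBelow 𝒮 G = filter (λ H → (H ⊆? G) ×-dec ¬? (H ≟ˢ G)) 𝒮

  G< : List (Subset n) → Subset n → Subset n
  G< 𝒮 G with strictlyBelow 𝒮 G
  ... | []     = ⊥
  ... | H ∷ Hs = join (H ∷ Hs)

  -- bases of ⊕_{G ∈ 𝒮 ∪ {[n]}} M[G_<, G]: unions of bases of the summands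
  SumBasis : List (Subset n) → Subset n → Set
  SumBasis 𝒮 B =
    ∃[ β ] ((∀ G → G ∈ₗ (⊤ ∷ 𝒮) → MinorBasis (G< 𝒮 G) G (β G))
            × B ≡ ⋃ (map β (⊤ ∷ 𝒮)))

weightVector : ∀ {n} → List (Subset n) → (Subset n → ℚ) → Fin n → ℚ
weightVector 𝒮 λG i = foldr ℚ._+_ 0ℚ (map (λ G → if ⌊ i ∈? G ⌋ then λG G else 0ℚ) 𝒮)

-- The weight of a base B is Σ_{G ∈ 𝒮} λ_G ∣B ∩ G∣ ≤ Σ_{G ∈ 𝒮} λ_G rank G, with equality exactly
-- when every B ∩ G is a basis of G ("adapted" bases); so once an adapted base exists, the bases
-- of M_𝒮 are the adapted ones. An adapted base B is the union of the sets B ∩ (G ∖ G<), which are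
-- bases of the minors M[G<, G]. Conversely, from bases β_G of the minors one shows by induction
-- along 𝒮 ∪ {[n]} that the union of the β_G' with G' ⊆ G is a basis of G; this also produces an
-- adapted base. The induction step needs the bases of the elements strictly below G to have an
-- independent union, and this is where nestedness enters: an antichain of at least two of them
-- has its join X outside 𝒢, so no factor of X (maximal element of 𝒢 below X) contains all of
-- them, and the building-set isomorphism ∏ [∅, F_j] ≅ [∅, X] makes independence in X factorwise.

module Submission where

open import Defs
open import Data.Nat as ℕ using (ℕ; zero; suc; z≤n; s≤s)
import Data.Nat.Properties as ℕP
open import Data.Nat.Induction using (<-wellFounded)
open import Induction.WellFounded using (Acc; acc)
open import Data.Fin using (Fin; zero; suc)
import Data.Fin.Properties as FinP
open import Data.Fin.Subset using (_⊈_)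
open import Data.Fin.Subset.Properties
open import Data.Bool using (true; false; if_then_else_)
open import Data.Vec using ([]; _∷_; here; there)
open import Data.List using (List; []; _∷_; map; filter; foldr; length; allFin; lookup)
open import Data.List.Properties
  using (filter-notAll; filter-all; map-tabulate; map-cong; map-cong-local)
open import Data.List.Relation.Unary.All as All using (All; []; _∷_)
open import Data.List.Relation.Unary.All.Properties using (¬Any⇒All¬; ¬All⇒Any¬; filter⁺)
open import Data.List.Relation.Unary.AllPairs using (AllPairs; []; _∷_)
open import Data.List.Relation.Unary.Any as Any using (Any; any?; here; there)
open import Data.List.Relation.Unary.Any.Properties using (lookup-index)
open import Data.List.Membership.Propositional using (find; lose)
open import Data.List.Membership.Propositional.Properties
  using (∈-map⁺; ∈-map⁻; ∈-filter⁺; ∈-filter⁻; ∈-++⁺ˡ; ∈-++⁺ʳ; ∈-lookup; ∈-allFin; foldr-selective)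
open import Data.Product using (∃-syntax; _×_; _,_; proj₁; proj₂)
open import Data.Sum as Sum using (_⊎_; inj₁; inj₂)
open import Data.Empty using (⊥-elim)
open import Function using (_∘_; id)
open import Function.Bundles using (_⇔_; mk⇔; Equivalence)
open import Relation.Nullary using (¬_; Dec; yes; no; ⌊_⌋)
open import Relation.Nullary.Decidable
  using (_×-dec_; _→-dec_; ¬?; toWitness; fromWitness; decidable-stable; isYes≗does)
open import Relation.Binary.PropositionalEquality
  using (_≡_; _≢_; refl; sym; trans; cong; subst; module ≡-Reasoning)

module FiniteSets where

  open import Data.Nat using (_+_; _≤_; _<_; _⊔_)

  private variable
    n : ℕ
    x y : Fin n
    p q r : Subset n

  Disjoint : Subset n → Subset n → Set
  Disjoint p q = ∀ {x} → x ∈ p → x ∉ q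

  x∈p─q⇒x∉q : ∀ (p q : Subset n) → x ∈ p ─ q → x ∉ q
  x∈p─q⇒x∉q {x = zero}  (_ ∷ p) (true ∷ q)  ()
  x∈p─q⇒x∉q {x = zero}  (_ ∷ p) (false ∷ q) _ ()
  x∈p─q⇒x∉q {x = suc x} (_ ∷ p) (_ ∷ q) (there x∈p─q) (there x∈q) = x∈p─q⇒x∉q p q x∈p─q x∈q

  x∈p─q⁻ : ∀ (p q : Subset n) → x ∈ p ─ q → x ∈ p × x ∉ q
  x∈p─q⁻ p q x∈p─q = p─q⊆p p q x∈p─q , x∈p─q⇒x∉q p q x∈p─q

  ∪-lub : p ⊆ r → q ⊆ r → p ∪ q ⊆ r
  ∪-lub {p = p} {q = q} p⊆r q⊆r x∈p∪q with x∈p∪q⁻ p q x∈p∪q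
  ... | inj₁ x∈p = p⊆r x∈p
  ... | inj₂ x∈q = q⊆r x∈q

  x∈p⇒⁅x⁆⊆p : x ∈ p → ⁅ x ⁆ ⊆ p
  x∈p⇒⁅x⁆⊆p {x = x} x∈p y∈⁅x⁆ = subst (_∈ _) (sym (x∈⁅y⁆⇒x≡y x y∈⁅x⁆)) x∈p

  p⊈q⇒∃∈∉ : p ⊈ q → ∃[ x ] (x ∈ p × x ∉ q)
  p⊈q⇒∃∈∉ {n} {p} {q} p⊈q
    with FinP.¬∀⟶∃¬ n (λ x → x ∈ p → x ∈ q) (λ x → (x ∈? p) →-dec (x ∈? q)) (λ h → p⊈q (h _))
  ... | x , ¬[x∈p⇒x∈q] with x ∈? p | x ∈? q
  ...   | _      | yes x∈q = ⊥-elim (¬[x∈p⇒x∈q] (λ _ → x∈q))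
  ...   | no x∉p | no _    = ⊥-elim (¬[x∈p⇒x∈q] (λ x∈p → ⊥-elim (x∉p x∈p)))
  ...   | yes x∈p | no x∉q = x , x∈p , x∉q

  ∣p∪q∣≡∣p∣+∣q∣ : ∀ (p q : Subset n) → Disjoint p q → ∣ p ∪ q ∣ ≡ ∣ p ∣ + ∣ q ∣
  ∣p∪q∣≡∣p∣+∣q∣ []          []          _ = refl
  ∣p∪q∣≡∣p∣+∣q∣ (true ∷ p)  (true ∷ q)  p#q = ⊥-elim (p#q here here)
  ∣p∪q∣≡∣p∣+∣q∣ (true ∷ p)  (false ∷ q) p#q =
    cong suc (∣p∪q∣≡∣p∣+∣q∣ p q (λ x∈p x∈q → p#q (there x∈p) (there x∈q)))
  ∣p∪q∣≡∣p∣+∣q∣ (false ∷ p) (true ∷ q)  p#q =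
    trans (cong suc (∣p∪q∣≡∣p∣+∣q∣ p q (λ x∈p x∈q → p#q (there x∈p) (there x∈q))))
          (sym (ℕP.+-suc ∣ p ∣ ∣ q ∣))
  ∣p∪q∣≡∣p∣+∣q∣ (false ∷ p) (false ∷ q) p#q =
    ∣p∪q∣≡∣p∣+∣q∣ p q (λ x∈p x∈q → p#q (there x∈p) (there x∈q))

  q⊆p⇒q∪[p─q]≡p : q ⊆ p → q ∪ (p ─ q) ≡ p
  q⊆p⇒q∪[p─q]≡p {q = q} {p = p} q⊆p = ⊆-antisym (∪-lub q⊆p (p─q⊆p p q)) p⊆q∪[p─q]
    where
    p⊆q∪[p─q] : p ⊆ q ∪ (p ─ q)
    p⊆q∪[p─q] {x} x∈p with x ∈? q
    ... | yes x∈q = p⊆p∪q (p ─ q) x∈q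
    ... | no x∉q  = q⊆p∪q q (p ─ q) (x∈p∧x∉q⇒x∈p─q x∈p x∉q)

  r⊆q⇒[p∩[q─r]]∪[p∩r]≡p∩q : r ⊆ q → (p ∩ (q ─ r)) ∪ (p ∩ r) ≡ p ∩ q
  r⊆q⇒[p∩[q─r]]∪[p∩r]≡p∩q {r = r} {q = q} {p = p} r⊆q = begin
    (p ∩ (q ─ r)) ∪ (p ∩ r)  ≡⟨ ∩-distribˡ-∪ p (q ─ r) r ⟨
    p ∩ ((q ─ r) ∪ r)        ≡⟨ cong (p ∩_) (trans (∪-comm (q ─ r) r) (q⊆p⇒q∪[p─q]≡p r⊆q)) ⟩
    p ∩ q                    ∎
    where open ≡-Reasoning

  q⊆p⇒∣p∣≡∣q∣+∣p─q∣ : q ⊆ p → ∣ p ∣ ≡ ∣ q ∣ + ∣ p ─ q ∣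
  q⊆p⇒∣p∣≡∣q∣+∣p─q∣ {q = q} {p = p} q⊆p =
    trans (cong ∣_∣ (sym (q⊆p⇒q∪[p─q]≡p q⊆p)))
          (∣p∪q∣≡∣p∣+∣q∣ q (p ─ q) (λ x∈q x∈p─q → x∈p─q⇒x∉q p q x∈p─q x∈q))

  x∉p⇒∣p∪⁅x⁆∣≡1+∣p∣ : x ∉ p → ∣ p ∪ ⁅ x ⁆ ∣ ≡ suc ∣ p ∣
  x∉p⇒∣p∪⁅x⁆∣≡1+∣p∣ {x = x} {p = p} x∉p = begin
    ∣ p ∪ ⁅ x ⁆ ∣      ≡⟨ ∣p∪q∣≡∣p∣+∣q∣ p ⁅ x ⁆ p#⁅x⁆ ⟩
    ∣ p ∣ + ∣ ⁅ x ⁆ ∣  ≡⟨ cong (∣ p ∣ +_) (∣⁅x⁆∣≡1 x) ⟩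
    ∣ p ∣ + 1          ≡⟨ ℕP.+-comm ∣ p ∣ 1 ⟩
    suc ∣ p ∣          ∎
    where
    open ≡-Reasoning
    p#⁅x⁆ : Disjoint p ⁅ x ⁆
    p#⁅x⁆ y∈p y∈⁅x⁆ = x∉p (subst (_∈ p) (x∈⁅y⁆⇒x≡y x y∈⁅x⁆) y∈p)

  x∈p⇒[p-x]∪⁅x⁆≡p : x ∈ p → (p - x) ∪ ⁅ x ⁆ ≡ p
  x∈p⇒[p-x]∪⁅x⁆≡p {x = x} {p = p} x∈p =
    trans (∪-comm (p - x) ⁅ x ⁆) (q⊆p⇒q∪[p─q]≡p (x∈p⇒⁅x⁆⊆p x∈p))

  x∈p⇒∣p∣≡1+∣p-x∣ : x ∈ p → ∣ p ∣ ≡ suc ∣ p - x ∣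
  x∈p⇒∣p∣≡1+∣p-x∣ {x = x} {p = p} x∈p =
    trans (cong ∣_∣ (sym (x∈p⇒[p-x]∪⁅x⁆≡p x∈p)))
          (x∉p⇒∣p∪⁅x⁆∣≡1+∣p∣ (λ x∈p-x → x∈p─q⇒x∉q p ⁅ x ⁆ x∈p-x (x∈⁅x⁆ x)))

  p⊆q∧∣q∣≤∣p∣⇒q≡p : p ⊆ q → ∣ q ∣ ≤ ∣ p ∣ → q ≡ p
  p⊆q∧∣q∣≤∣p∣⇒q≡p {p = p} {q = q} p⊆q ∣q∣≤∣p∣ with q ⊆? p
  ... | yes q⊆p = ⊆-antisym q⊆p p⊆q
  ... | no q⊈p with p⊈q⇒∃∈∉ q⊈p
  ...   | x , x∈q , x∉p = ⊥-elim (ℕP.<⇒≱ (p⊂q⇒∣p∣<∣q∣ (p⊆q , x , x∈q , x∉p)) ∣q∣≤∣p∣)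

  p⊆q∧p≢q⇒∣p∣<∣q∣ : p ⊆ q → p ≢ q → ∣ p ∣ < ∣ q ∣
  p⊆q∧p≢q⇒∣p∣<∣q∣ p⊆q p≢q = ℕP.≰⇒> (λ ∣q∣≤∣p∣ → p≢q (sym (p⊆q∧∣q∣≤∣p∣⇒q≡p p⊆q ∣q∣≤∣p∣)))

  r⊆p∧x∉r⇒r⊆p-x : r ⊆ p → x ∉ r → r ⊆ p - x
  r⊆p∧x∉r⇒r⊆p-x {x = x} r⊆p x∉r z∈r =
    x∈p∧x∉q⇒x∈p─q (r⊆p z∈r) (λ z∈⁅x⁆ → x∉r (subst (_∈ _) (x∈⁅y⁆⇒x≡y x z∈⁅x⁆) z∈r))

  r⊆p∧x∉r⇒r⊆[p-x]∪⁅y⁆ : r ⊆ p → x ∉ r → r ⊆ (p - x) ∪ ⁅ y ⁆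
  r⊆p∧x∉r⇒r⊆[p-x]∪⁅y⁆ {y = y} r⊆p x∉r z∈r = p⊆p∪q ⁅ y ⁆ (r⊆p∧x∉r⇒r⊆p-x r⊆p x∉r z∈r)

  ∣[p-x]∪⁅y⁆∣≡∣p∣ : x ∈ p → y ∉ p → ∣ (p - x) ∪ ⁅ y ⁆ ∣ ≡ ∣ p ∣
  ∣[p-x]∪⁅y⁆∣≡∣p∣ {x = x} {p = p} x∈p y∉p =
    trans (x∉p⇒∣p∪⁅x⁆∣≡1+∣p∣ (λ y∈p-x → y∉p (p─q⊆p p ⁅ x ⁆ y∈p-x))) (sym (x∈p⇒∣p∣≡1+∣p-x∣ x∈p))

  ∣[p-x]∪⁅y⁆─q∣<∣p─q∣ : x ∈ p → x ∉ q → y ∈ q → ∣ ((p - x) ∪ ⁅ y ⁆) ─ q ∣ < ∣ p ─ q ∣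
  ∣[p-x]∪⁅y⁆─q∣<∣p─q∣ {x = x} {p = p} {q = q} {y = y} x∈p x∉q y∈q =
    p⊂q⇒∣p∣<∣q∣ (shrinks , x , x∈p∧x∉q⇒x∈p─q x∈p x∉q , x∉new)
    where
    new = ((p - x) ∪ ⁅ y ⁆) ─ q
    shrinks : new ⊆ p ─ q
    shrinks {z} z∈new with x∈p─q⁻ _ q z∈new
    ... | z∈p-x∪y , z∉q with x∈p∪q⁻ (p - x) ⁅ y ⁆ z∈p-x∪y
    ...   | inj₁ z∈p-x = x∈p∧x∉q⇒x∈p─q (p─q⊆p p ⁅ x ⁆ z∈p-x) z∉q
    ...   | inj₂ z∈⁅y⁆ = ⊥-elim (z∉q (subst (_∈ q) (sym (x∈⁅y⁆⇒x≡y y z∈⁅y⁆)) y∈q))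
    x∉new : x ∉ new
    x∉new x∈new with x∈p∪q⁻ (p - x) ⁅ y ⁆ (p─q⊆p _ q x∈new)
    ... | inj₁ x∈p-x = x∈p─q⇒x∉q p ⁅ x ⁆ x∈p-x (x∈⁅x⁆ x)
    ... | inj₂ x∈⁅y⁆ = x∉q (subst (_∈ q) (sym (x∈⁅y⁆⇒x≡y y x∈⁅y⁆)) y∈q)

  x∈⋃⁻ : ∀ (ps : List (Subset n)) → x ∈ ⋃ ps → ∃[ p ] (p ∈ₗ ps × x ∈ p)
  x∈⋃⁻ []       x∈⊥ = ⊥-elim (∉⊥ x∈⊥)
  x∈⋃⁻ (p ∷ ps) x∈⋃ with x∈p∪q⁻ p (⋃ ps) x∈⋃
  ... | inj₁ x∈p = p , here refl , x∈p
  ... | inj₂ x∈⋃ps with x∈⋃⁻ ps x∈⋃ps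
  ...   | q , q∈ps , x∈q = q , there q∈ps , x∈q

  p∈ps⇒p⊆⋃ps : ∀ {ps : List (Subset n)} → p ∈ₗ ps → p ⊆ ⋃ ps
  p∈ps⇒p⊆⋃ps {ps = q ∷ ps} (here refl) = p⊆p∪q (⋃ ps)
  p∈ps⇒p⊆⋃ps {ps = q ∷ ps} (there p∈ps) = λ x∈p → q⊆p∪q q (⋃ ps) (p∈ps⇒p⊆⋃ps p∈ps x∈p)

  ⋃-lub : ∀ (ps : List (Subset n)) → (∀ {p} → p ∈ₗ ps → p ⊆ r) → ⋃ ps ⊆ r
  ⋃-lub ps ps⊆r x∈⋃ with x∈⋃⁻ ps x∈⋃
  ... | p , p∈ps , x∈p = ps⊆r p∈ps x∈p

  module _ {A : Set} (f : A → Subset n) where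

    x∈⋃map⁻ : ∀ (as : List A) → x ∈ ⋃ (map f as) → ∃[ a ] (a ∈ₗ as × x ∈ f a)
    x∈⋃map⁻ as x∈⋃ with x∈⋃⁻ (map f as) x∈⋃
    ... | _ , fa∈ , x∈fa with ∈-map⁻ f fa∈
    ...   | a , a∈as , refl = a , a∈as , x∈fa

    a∈as⇒fa⊆⋃map : ∀ {a} {as : List A} → a ∈ₗ as → f a ⊆ ⋃ (map f as)
    a∈as⇒fa⊆⋃map a∈as = p∈ps⇒p⊆⋃ps (∈-map⁺ f a∈as)

    ⋃map-lub : ∀ (as : List A) → (∀ {a} → a ∈ₗ as → f a ⊆ r) → ⋃ (map f as) ⊆ r
    ⋃map-lub as fas⊆r x∈⋃ with x∈⋃map⁻ as x∈⋃
    ... | a , a∈as , x∈fa = fas⊆r a∈as x∈fa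

  ShorterCover : List (Subset n) → Set
  ShorterCover ps = ∃[ qs ] (length qs < length ps × (∀ {q} → q ∈ₗ qs → q ∈ₗ ps) ×
                             (∀ {p} → p ∈ₗ ps → ∃[ q ] (q ∈ₗ qs × p ⊆ q)))

  shorterCover-drop-below : ∀ {ps : List (Subset n)} → q ∈ₗ ps → q ⊆ p → ShorterCover (p ∷ ps)
  shorterCover-drop-below {q = q} {p = p} {ps} q∈ps q⊆p =
    p ∷ notBelow , s≤s shorter , members , dominated
    where
    notBelow = filter (λ r → ¬? (r ⊆? p)) ps
    shorter : length notBelow < length ps
    shorter = filter-notAll (λ r → ¬? (r ⊆? p)) ps (lose q∈ps (λ q⊈p → q⊈p q⊆p))
    members : ∀ {r} → r ∈ₗ p ∷ notBelow → r ∈ₗ p ∷ ps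
    members (here refl) = here refl
    members (there r∈) = there (proj₁ (∈-filter⁻ (λ r → ¬? (r ⊆? p)) {xs = ps} r∈))
    dominated : ∀ {r} → r ∈ₗ p ∷ ps → ∃[ s ] (s ∈ₗ p ∷ notBelow × r ⊆ s)
    dominated (here refl) = p , here refl , ⊆-refl
    dominated {r} (there r∈ps) with r ⊆? p
    ... | yes r⊆p = p , here refl , r⊆p
    ... | no r⊈p = r , there (∈-filter⁺ (λ r → ¬? (r ⊆? p)) r∈ps r⊈p) , ⊆-refl

  shorterCover-drop-head : ∀ {ps : List (Subset n)} → q ∈ₗ ps → p ⊆ q → ShorterCover (p ∷ ps)
  shorterCover-drop-head {q = q} {ps = ps} q∈ps p⊆q = ps , ℕP.n<1+n _ , there , dominated
    where
    dominated : ∀ {r} → r ∈ₗ _ ∷ ps → ∃[ s ] (s ∈ₗ ps × r ⊆ s)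
    dominated (here refl) = q , q∈ps , p⊆q
    dominated {r} (there r∈ps) = r , r∈ps , ⊆-refl

  shorterCover-∷ : ∀ {ps : List (Subset n)} → ShorterCover ps → ShorterCover (p ∷ ps)
  shorterCover-∷ {p = p} (qs , shorter , members , dominated) =
    p ∷ qs , s≤s shorter , members′ , dominated′
    where
    members′ : ∀ {r} → r ∈ₗ p ∷ qs → r ∈ₗ p ∷ _
    members′ (here refl) = here refl
    members′ (there r∈qs) = there (members r∈qs)
    dominated′ : ∀ {r} → r ∈ₗ p ∷ _ → ∃[ s ] (s ∈ₗ p ∷ qs × r ⊆ s)
    dominated′ (here refl) = p , here refl , ⊆-refl
    dominated′ (there r∈ps) with dominated r∈ps
    ... | s , s∈qs , r⊆s = s , there s∈qs , r⊆s

  antichain⊎shorterCover : ∀ (ps : List (Subset n)) →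
    AllPairs (λ p q → p ⊈ q × q ⊈ p) ps ⊎ ShorterCover ps
  antichain⊎shorterCover [] = inj₁ []
  antichain⊎shorterCover (p ∷ ps) with any? (_⊆? p) ps | any? (p ⊆?_) ps
  ... | yes below | _ =
    let (q , q∈ps , q⊆p) = find below in inj₂ (shorterCover-drop-below q∈ps q⊆p)
  ... | no _ | yes above =
    let (q , q∈ps , p⊆q) = find above in inj₂ (shorterCover-drop-head q∈ps p⊆q)
  ... | no ¬below | no ¬above =
    Sum.map (All.zip (¬Any⇒All¬ ps ¬above , ¬Any⇒All¬ ps ¬below) ∷_) shorterCover-∷
            (antichain⊎shorterCover ps)

  x∈xs⇒x≤foldr⊔ : ∀ {x} {xs : List ℕ} → x ∈ₗ xs → x ≤ foldr _⊔_ 0 xs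
  x∈xs⇒x≤foldr⊔ {xs = y ∷ ys} (here refl) = ℕP.m≤m⊔n y _
  x∈xs⇒x≤foldr⊔ {xs = y ∷ ys} (there x∈ys) = ℕP.≤-trans (x∈xs⇒x≤foldr⊔ x∈ys) (ℕP.m≤n⊔m y _)

  ∈-subsets : ∀ (p : Subset n) → p ∈ₗ subsets n
  ∈-subsets [] = here refl
  ∈-subsets {suc n} (true ∷ p) = ∈-++⁺ˡ (∈-map⁺ (true ∷_) (∈-subsets p))
  ∈-subsets {suc n} (false ∷ p) =
    ∈-++⁺ʳ (map (true ∷_) (subsets n)) (∈-map⁺ (false ∷_) (∈-subsets p))

module MatroidTheory {n : ℕ} (M : Matroid n) where

  open import Data.Nat using (_+_; _≤_; _<_; _∸_)
  open import Data.Vec.Properties using ([]=⇒lookup; lookup⇒[]=; lookup∘tabulate)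
  open import Data.Bool.Properties using (T-≡)
  open FiniteSets

  private variable
    e z : Fin n
    B B₁ B₂ I J U X Y F G β : Subset n

  indep-antimono : I ⊆ J → Indep M J → Indep M I
  indep-antimono I⊆J = Any.map (⊆-trans I⊆J)

  base⇒indep : B ∈ₗ bases M → Indep M B
  base⇒indep = Any.map ⊆-reflexive

  indep⇒⊆base : Indep M I → ∃[ B ] (B ∈ₗ bases M × I ⊆ B)
  indep⇒⊆base = find

  indep-⊥ : Indep M ⊥
  indep-⊥ = indep-antimono (⊆-min _) (base⇒indep (proj₂ (nonempty M)))

  base⊆base⇒≡ : B₁ ∈ₗ bases M → B₂ ∈ₗ bases M → B₁ ⊆ B₂ → B₁ ≡ B₂
  base⊆base⇒≡ {B₁} {B₂} b₁ b₂ B₁⊆B₂ = ⊆-antisym B₁⊆B₂ B₂⊆B₁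
    where
    B₂⊆B₁ : B₂ ⊆ B₁
    B₂⊆B₁ {x} x∈B₂ with x ∈? B₁
    ... | yes x∈B₁ = x∈B₁
    ... | no x∉B₁ with exchange M b₂ b₁ x∈B₂ x∉B₁
    ...   | y , y∈B₁ , y∉B₂ , _ = ⊥-elim (y∉B₂ (B₁⊆B₂ y∈B₁))

  exchange-towards : ∀ {B₁ B₂ I} → B₁ ∈ₗ bases M → B₂ ∈ₗ bases M → I ⊆ B₁ →
                     ∃[ B ] (B ∈ₗ bases M × ∣ B ∣ ≡ ∣ B₁ ∣ × I ⊆ B × B ─ I ⊆ B₂)
  exchange-towards {B₁} {B₂} {I} b₁ b₂ I⊆B₁ = go B₁ (<-wellFounded _) b₁ refl I⊆B₁
    where
    go : ∀ B → Acc _<_ ∣ B ─ B₂ ∣ → B ∈ₗ bases M → ∣ B ∣ ≡ ∣ B₁ ∣ → I ⊆ B →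
         ∃[ B' ] (B' ∈ₗ bases M × ∣ B' ∣ ≡ ∣ B₁ ∣ × I ⊆ B' × B' ─ I ⊆ B₂)
    go B (acc rec) b ∣B∣≡∣B₁∣ I⊆B with (B ─ I) ⊆? B₂
    ... | yes B─I⊆B₂ = B , b , ∣B∣≡∣B₁∣ , I⊆B , B─I⊆B₂
    ... | no B─I⊈B₂ with p⊈q⇒∃∈∉ B─I⊈B₂
    ...   | x , x∈B─I , x∉B₂ with x∈p─q⁻ B I x∈B─I
    ...     | x∈B , x∉I with exchange M b b₂ x∈B x∉B₂
    ...       | y , y∈B₂ , y∉B , b' =
      go _ (rec (∣[p-x]∪⁅y⁆─q∣<∣p─q∣ x∈B x∉B₂ y∈B₂)) b'
         (trans (∣[p-x]∪⁅y⁆∣≡∣p∣ x∈B y∉B) ∣B∣≡∣B₁∣) (r⊆p∧x∉r⇒r⊆[p-x]∪⁅y⁆ I⊆B x∉I)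

  bases-equicardinal : B₁ ∈ₗ bases M → B₂ ∈ₗ bases M → ∣ B₁ ∣ ≡ ∣ B₂ ∣
  bases-equicardinal b₁ b₂ with exchange-towards {I = ⊥} b₁ b₂ (⊆-min _)
  ... | B , b , ∣B∣≡∣B₁∣ , _ , B─⊥⊆B₂ =
    trans (sym ∣B∣≡∣B₁∣) (cong ∣_∣ (base⊆base⇒≡ b b₂ (subst (_⊆ _) (p─⊥≡p B) B─⊥⊆B₂)))

  basisOf-intro : I ⊆ X → Indep M I → (∀ {z} → z ∈ X → Indep M (I ∪ ⁅ z ⁆) → z ∈ I) →
                  BasisOf M X I
  basisOf-intro I⊆X indI absorbs = I⊆X , indI , λ J I⊆J J⊆X indJ →
    ⊆-antisym (λ z∈J → absorbs (J⊆X z∈J) (indep-antimono (∪-lub I⊆J (x∈p⇒⁅x⁆⊆p z∈J)) indJ)) I⊆J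

  basisOf-absorbs : BasisOf M X I → z ∈ X → Indep M (I ∪ ⁅ z ⁆) → z ∈ I
  basisOf-absorbs {z = z} (I⊆X , _ , maximal) z∈X indI∪z =
    subst (z ∈_) (maximal _ (p⊆p∪q _) (∪-lub I⊆X (x∈p⇒⁅x⁆⊆p z∈X)) indI∪z) (q⊆p∪q _ _ (x∈⁅x⁆ z))

  basisOf-self : Indep M I → BasisOf M I I
  basisOf-self indI = basisOf-intro ⊆-refl indI (λ z∈I _ → z∈I)

  basisOf-⊆ : BasisOf M X I → I ⊆ Y → Y ⊆ X → BasisOf M Y I
  basisOf-⊆ basis I⊆Y Y⊆X =
    basisOf-intro I⊆Y (proj₁ (proj₂ basis)) (λ z∈Y → basisOf-absorbs basis (Y⊆X z∈Y))

  -- Exchange a base B ⊇ I towards a base B₂ ⊇ J until B ─ I ⊆ B₂; then B ─ I even avoids J,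
  -- and counting gives ∣ J ∣ ≤ ∣ I ∣.
  ∣indep∣≤∣basisOf∣ : BasisOf M X I → J ⊆ X → Indep M J → ∣ J ∣ ≤ ∣ I ∣
  ∣indep∣≤∣basisOf∣ {X} {I} {J} basis J⊆X indJ
    with indep⇒⊆base (proj₁ (proj₂ basis)) | indep⇒⊆base indJ
  ... | B₁ , b₁ , I⊆B₁ | B₂ , b₂ , J⊆B₂ with exchange-towards b₁ b₂ I⊆B₁
  ...   | B , b , _ , I⊆B , B─I⊆B₂ = ℕP.+-cancelʳ-≤ (∣ B₂ ─ J ∣) (∣ J ∣) (∣ I ∣) (begin
      ∣ J ∣ + ∣ B₂ ─ J ∣  ≡⟨ sym (q⊆p⇒∣p∣≡∣q∣+∣p─q∣ J⊆B₂) ⟩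
      ∣ B₂ ∣              ≡⟨ bases-equicardinal b₂ b ⟩
      ∣ B ∣               ≡⟨ q⊆p⇒∣p∣≡∣q∣+∣p─q∣ I⊆B ⟩
      ∣ I ∣ + ∣ B ─ I ∣   ≤⟨ ℕP.+-monoʳ-≤ ∣ I ∣ (p⊆q⇒∣p∣≤∣q∣ B─I⊆B₂─J) ⟩
      ∣ I ∣ + ∣ B₂ ─ J ∣  ∎)
    where
    open ℕP.≤-Reasoning
    B─I⊆B₂─J : B ─ I ⊆ B₂ ─ J
    B─I⊆B₂─J z∈B─I with x∈p─q⁻ B I z∈B─I
    ... | z∈B , z∉I = x∈p∧x∉q⇒x∈p─q (B─I⊆B₂ z∈B─I) λ z∈J →
      z∉I (basisOf-absorbs basis (J⊆X z∈J)
             (indep-antimono (∪-lub I⊆B (x∈p⇒⁅x⁆⊆p z∈B)) (base⇒indep b)))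

  ∣basisOf∣≤∣indep∣⇒basisOf : BasisOf M X I → J ⊆ X → Indep M J → ∣ I ∣ ≤ ∣ J ∣ → BasisOf M X J
  ∣basisOf∣≤∣indep∣⇒basisOf basis J⊆X indJ ∣I∣≤∣J∣ = J⊆X , indJ , λ K J⊆K K⊆X indK →
    p⊆q∧∣q∣≤∣p∣⇒q≡p J⊆K (ℕP.≤-trans (∣indep∣≤∣basisOf∣ basis K⊆X indK) ∣I∣≤∣J∣)

  basisOf-extending : I ⊆ Y → Indep M I → ∃[ I' ] (I ⊆ I' × BasisOf M Y I')
  basisOf-extending {I₀} {Y} I₀⊆Y indI₀ = go I₀ (<-wellFounded _) I₀⊆Y indI₀ ⊆-refl
    where
    go : ∀ I → Acc _<_ (n ∸ ∣ I ∣) → I ⊆ Y → Indep M I → I₀ ⊆ I →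
         ∃[ I' ] (I₀ ⊆ I' × BasisOf M Y I')
    go I (acc rec) I⊆Y indI I₀⊆I
      with FinP.any? (λ e → (e ∈? Y) ×-dec ¬? (e ∈? I) ×-dec indep? M (I ∪ ⁅ e ⁆))
    ... | yes (e , e∈Y , e∉I , indI∪e) =
      go (I ∪ ⁅ e ⁆) (rec (ℕP.∸-monoʳ-< ∣I∣<∣I∪e∣ (∣p∣≤n (I ∪ ⁅ e ⁆))))
         (∪-lub I⊆Y (x∈p⇒⁅x⁆⊆p e∈Y)) indI∪e (⊆-trans I₀⊆I (p⊆p∪q _))
      where
      ∣I∣<∣I∪e∣ : ∣ I ∣ < ∣ I ∪ ⁅ e ⁆ ∣
      ∣I∣<∣I∪e∣ = ℕP.≤-reflexive (sym (x∉p⇒∣p∪⁅x⁆∣≡1+∣p∣ e∉I))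
    ... | no ¬extensible = I , I₀⊆I , basisOf-intro I⊆Y indI absorbs
      where
      absorbs : z ∈ Y → Indep M (I ∪ ⁅ z ⁆) → z ∈ I
      absorbs {z} z∈Y indI∪z with z ∈? I
      ... | yes z∈I = z∈I
      ... | no z∉I = ⊥-elim (¬extensible (z , z∈Y , z∉I , indI∪z))

  basisOf-exists : ∀ X → ∃[ I ] (BasisOf M X I)
  basisOf-exists X with basisOf-extending (⊆-min X) indep-⊥
  ... | I , _ , basis = I , basis

  ∣indep∣≤rank : J ⊆ X → Indep M J → ∣ J ∣ ≤ rank M X
  ∣indep∣≤rank {J} {X} J⊆X indJ = x∈xs⇒x≤foldr⊔
    (∈-map⁺ ∣_∣ (∈-filter⁺ (λ Y → (Y ⊆? X) ×-dec indep? M Y) (∈-subsets J) (J⊆X , indJ)))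

  rank-attained : ∀ X → ∃[ J ] (J ⊆ X × Indep M J × rank M X ≤ ∣ J ∣)
  rank-attained X with foldr-selective ℕP.⊔-sel 0 (map ∣_∣ candidates)
    where candidates = filter (λ Y → (Y ⊆? X) ×-dec indep? M Y) (subsets n)
  ... | inj₁ rank≡0 = ⊥ , ⊆-min X , indep-⊥ , ℕP.≤-trans (ℕP.≤-reflexive rank≡0) ℕ.z≤n
  ... | inj₂ rank∈ with ∈-map⁻ ∣_∣ rank∈
  ...   | J , J∈ , rank≡∣J∣ with ∈-filter⁻ (λ Y → (Y ⊆? X) ×-dec indep? M Y) {xs = subsets n} J∈
  ...     | _ , J⊆X , indJ = J , J⊆X , indJ , ℕP.≤-reflexive rank≡∣J∣

  rank≡∣basisOf∣ : BasisOf M X I → rank M X ≡ ∣ I ∣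
  rank≡∣basisOf∣ {X} basis@(I⊆X , indI , _) with rank-attained X
  ... | J , J⊆X , indJ , rank≤∣J∣ =
    ℕP.≤-antisym (ℕP.≤-trans rank≤∣J∣ (∣indep∣≤∣basisOf∣ basis J⊆X indJ)) (∣indep∣≤rank I⊆X indI)

  rank≤∣indep∣⇒basisOf : J ⊆ X → Indep M J → rank M X ≤ ∣ J ∣ → BasisOf M X J
  rank≤∣indep∣⇒basisOf {J} {X} J⊆X indJ rank≤∣J∣ =
    let (I , basisI) = basisOf-exists X
    in ∣basisOf∣≤∣indep∣⇒basisOf basisI J⊆X indJ (subst (_≤ ∣ J ∣) (rank≡∣basisOf∣ basisI) rank≤∣J∣)

  ∈cl⁺ : rank M (X ∪ ⁅ e ⁆) ≡ rank M X → e ∈ cl M X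
  ∈cl⁺ {X} {e} eq = lookup⇒[]= e (cl M X) (trans (lookup∘tabulate _ e)
    (Equivalence.to T-≡ (fromWitness {a? = rank M (X ∪ ⁅ e ⁆) ℕ.≟ rank M X} eq)))

  ∈cl⁻ : e ∈ cl M X → rank M (X ∪ ⁅ e ⁆) ≡ rank M X
  ∈cl⁻ {e} {X} e∈cl = toWitness {a? = rank M (X ∪ ⁅ e ⁆) ℕ.≟ rank M X}
    (Equivalence.from T-≡ (trans (sym (lookup∘tabulate _ e)) ([]=⇒lookup e∈cl)))

  X⊆clX : X ⊆ cl M X
  X⊆clX {X} e∈X = ∈cl⁺ (cong (rank M) (⊆-antisym (∪-lub ⊆-refl (x∈p⇒⁅x⁆⊆p e∈X)) (p⊆p∪q _)))

  ∈cl⇔ : BasisOf M X I → e ∈ cl M X ⇔ (Indep M (I ∪ ⁅ e ⁆) → e ∈ I)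
  ∈cl⇔ {X} {I} {e} basis@(I⊆X , indI , _) = mk⇔ absorbs spanned
    where
    absorbs : e ∈ cl M X → Indep M (I ∪ ⁅ e ⁆) → e ∈ I
    absorbs e∈cl indI∪e with e ∈? I
    ... | yes e∈I = e∈I
    ... | no e∉I = ⊥-elim (ℕP.<-irrefl refl (begin-strict
      rank M X             ≡⟨ rank≡∣basisOf∣ basis ⟩
      ∣ I ∣                <⟨ ℕP.n<1+n ∣ I ∣ ⟩
      suc ∣ I ∣            ≡⟨ sym (x∉p⇒∣p∪⁅x⁆∣≡1+∣p∣ e∉I) ⟩
      ∣ I ∪ ⁅ e ⁆ ∣        ≤⟨ ∣indep∣≤rank (∪-lub (⊆-trans I⊆X (p⊆p∪q _)) (q⊆p∪q X _)) indI∪e ⟩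
      rank M (X ∪ ⁅ e ⁆)   ≡⟨ ∈cl⁻ e∈cl ⟩
      rank M X             ∎))
      where open ℕP.≤-Reasoning
    spanned : (Indep M (I ∪ ⁅ e ⁆) → e ∈ I) → e ∈ cl M X
    spanned absorbs with indep? M (I ∪ ⁅ e ⁆)
    ... | yes indI∪e = X⊆clX (I⊆X (absorbs indI∪e))
    ... | no depI∪e = ∈cl⁺ (trans (rank≡∣basisOf∣ basisOfX∪e) (sym (rank≡∣basisOf∣ basis)))
      where
      basisOfX∪e : BasisOf M (X ∪ ⁅ e ⁆) I
      basisOfX∪e = basisOf-intro (⊆-trans I⊆X (p⊆p∪q _)) indI absorbs′
        where
        absorbs′ : z ∈ X ∪ ⁅ e ⁆ → Indep M (I ∪ ⁅ z ⁆) → z ∈ I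
        absorbs′ z∈X∪e indI∪z with x∈p∪q⁻ X ⁅ e ⁆ z∈X∪e
        ... | inj₁ z∈X = basisOf-absorbs basis z∈X indI∪z
        ... | inj₂ z∈⁅e⁆ with x∈⁅y⁆⇒x≡y e z∈⁅e⁆
        ...   | refl = ⊥-elim (depI∪e indI∪z)

  basisOf-cl : BasisOf M X I → BasisOf M (cl M X) I
  basisOf-cl basis@(I⊆X , indI , _) =
    basisOf-intro (⊆-trans I⊆X X⊆clX) indI (Equivalence.to (∈cl⇔ basis))

  cl-mono : X ⊆ Y → cl M X ⊆ cl M Y
  cl-mono {X} {Y} X⊆Y e∈clX with basisOf-exists X
  ... | I , basisX with basisOf-extending (⊆-trans (proj₁ basisX) X⊆Y) (proj₁ (proj₂ basisX))
  ...   | I' , I⊆I' , basisY = Equivalence.from (∈cl⇔ basisY) λ indI'∪e →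
    I⊆I' (Equivalence.to (∈cl⇔ basisX) e∈clX
      (indep-antimono (∪-lub (⊆-trans I⊆I' (p⊆p∪q _)) (q⊆p∪q _ _)) indI'∪e))

  cl-idem : cl M (cl M X) ⊆ cl M X
  cl-idem {X} e∈clclX with basisOf-exists X
  ... | I , basis = Equivalence.from (∈cl⇔ basis) (Equivalence.to (∈cl⇔ (basisOf-cl basis)) e∈clclX)

  cl-isFlat : ∀ X → IsFlat M (cl M X)
  cl-isFlat X = ⊆-antisym cl-idem X⊆clX

  cl-least : IsFlat M F → X ⊆ F → cl M X ⊆ F
  cl-least flat X⊆F e∈clX = subst (_ ∈_) flat (cl-mono X⊆F e∈clX)

  ∈cl∧indep-∪⇒∈ : z ∈ cl M I → Indep M (I ∪ ⁅ z ⁆) → z ∈ I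
  ∈cl∧indep-∪⇒∈ z∈clI indI∪z =
    Equivalence.to (∈cl⇔ (basisOf-self (indep-antimono (p⊆p∪q _) indI∪z))) z∈clI indI∪z

  spanning⇒basisOf : Indep M I → I ⊆ X → X ⊆ cl M I → BasisOf M X I
  spanning⇒basisOf indI I⊆X X⊆clI = basisOf-intro I⊆X indI (λ z∈X → ∈cl∧indep-∪⇒∈ (X⊆clI z∈X))

  basisOf⇒spanning : BasisOf M X I → X ⊆ cl M I
  basisOf⇒spanning basis@(_ , indI , _) z∈X =
    Equivalence.from (∈cl⇔ (basisOf-self indI)) (basisOf-absorbs basis z∈X)

  indep⇒∉cl[-] : Indep M J → z ∈ J → z ∉ cl M (J - z)
  indep⇒∉cl[-] {J} {z} indJ z∈J z∈cl =
    x∈p─q⇒x∉q J ⁅ z ⁆ (Equivalence.to (∈cl⇔ (basisOf-self indJ-z)) z∈cl indJ-z∪z) (x∈⁅x⁆ z)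
    where
    indJ-z = indep-antimono (p─q⊆p J ⁅ z ⁆) indJ
    indJ-z∪z = subst (Indep M) (sym (x∈p⇒[p-x]∪⁅x⁆≡p z∈J)) indJ

  dep⇒∃∈cl[-] : ¬ Indep M J → ∃[ z ] (z ∈ J × z ∈ cl M (J - z))
  dep⇒∃∈cl[-] {J} depJ with basisOf-exists J
  ... | I , basis@(I⊆J , indI , _) with J ⊆? I
  ...   | yes J⊆I = ⊥-elim (depJ (indep-antimono J⊆I indI))
  ...   | no J⊈I with p⊈q⇒∃∈∉ J⊈I
  ...     | z , z∈J , z∉I = z , z∈J ,
    Equivalence.from (∈cl⇔ (basisOf-⊆ basis (r⊆p∧x∉r⇒r⊆p-x I⊆J z∉I) (p─q⊆p J _)))
      (basisOf-absorbs basis z∈J)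

  ⊤-isFlat : IsFlat M ⊤
  ⊤-isFlat = ⊆-antisym ⊆⊤ X⊆clX

  base⇔basisOf⊤ : B ∈ₗ bases M ⇔ BasisOf M ⊤ B
  base⇔basisOf⊤ {B} = mk⇔ base⇒basisOf⊤ basisOf⊤⇒base
    where
    base⇒basisOf⊤ : B ∈ₗ bases M → BasisOf M ⊤ B
    base⇒basisOf⊤ b = basisOf-intro ⊆⊤ (base⇒indep b) absorbs
      where
      absorbs : z ∈ ⊤ → Indep M (B ∪ ⁅ z ⁆) → z ∈ B
      absorbs _ indB∪z with indep⇒⊆base indB∪z
      ... | B' , b' , B∪z⊆B' = subst (_ ∈_) (sym (base⊆base⇒≡ b b' (⊆-trans (p⊆p∪q _) B∪z⊆B')))
                                       (B∪z⊆B' (q⊆p∪q _ _ (x∈⁅x⁆ _)))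
    basisOf⊤⇒base : BasisOf M ⊤ B → B ∈ₗ bases M
    basisOf⊤⇒base (_ , indB , maximal) with indep⇒⊆base indB
    ... | B' , b' , B⊆B' = subst (_∈ₗ bases M) (maximal B' B⊆B' ⊆⊤ (base⇒indep b')) b'

  basisOf-contraction-invariant : F ⊆ G → BasisOf M F I → BasisOf M F U → β ⊆ G ─ F →
                                  BasisOf M G (β ∪ I) → BasisOf M G (β ∪ U)
  basisOf-contraction-invariant {F} {G} {I} {U} {β} F⊆G basisI basisU β⊆G─F basisβ∪I
    with basisOf-extending (⊆-trans (proj₁ basisU) (q⊆p∪q β F)) (proj₁ (proj₂ basisU))
  ... | U' , U⊆U' , basisU'@(U'⊆β∪F , indU' , _) =
    ∣basisOf∣≤∣indep∣⇒basisOf basisβ∪I β∪U⊆G (subst (Indep M) (sym β∪U≡U') indU')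
                               (ℕP.≤-reflexive ∣β∪I∣≡∣β∪U∣)
    where
    β#F : Disjoint β F
    β#F z∈β = x∈p─q⇒x∉q G F (β⊆G─F z∈β)
    ∣β∪I∣≡∣β∪U∣ : ∣ β ∪ I ∣ ≡ ∣ β ∪ U ∣
    ∣β∪I∣≡∣β∪U∣ = begin
      ∣ β ∪ I ∣      ≡⟨ ∣p∪q∣≡∣p∣+∣q∣ β I (λ z∈β → β#F z∈β ∘ proj₁ basisI) ⟩
      ∣ β ∣ + ∣ I ∣  ≡⟨ cong (∣ β ∣ +_) (trans (sym (rank≡∣basisOf∣ basisI))
                                               (rank≡∣basisOf∣ basisU)) ⟩
      ∣ β ∣ + ∣ U ∣  ≡⟨ sym (∣p∪q∣≡∣p∣+∣q∣ β U (λ z∈β → β#F z∈β ∘ proj₁ basisU)) ⟩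
      ∣ β ∪ U ∣      ∎
      where open ≡-Reasoning
    β∪U⊆G : β ∪ U ⊆ G
    β∪U⊆G = ∪-lub (⊆-trans β⊆G─F (p─q⊆p G F)) (⊆-trans (proj₁ basisU) F⊆G)
    U'⊆β∪U : U' ⊆ β ∪ U
    U'⊆β∪U z∈U' with x∈p∪q⁻ β F (U'⊆β∪F z∈U')
    ... | inj₁ z∈β = p⊆p∪q U z∈β
    ... | inj₂ z∈F = q⊆p∪q β U
      (basisOf-absorbs basisU z∈F (indep-antimono (∪-lub U⊆U' (x∈p⇒⁅x⁆⊆p z∈U')) indU'))
    β∪U≡U' : β ∪ U ≡ U'
    β∪U≡U' = p⊆q∧∣q∣≤∣p∣⇒q≡p U'⊆β∪U (subst (_≤ ∣ U' ∣) ∣β∪I∣≡∣β∪U∣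
      (∣indep∣≤∣basisOf∣ basisU' (∪-lub (p⊆p∪q F) (⊆-trans (proj₁ basisI) (q⊆p∪q β F)))
                         (proj₁ (proj₂ basisβ∪I))))

  -- Stated for all F and G because SumBasis asks for a total family of minor bases.
  minorBasis-exists : ∀ F G → ∃[ β ] (F ⊆ G → MinorBasis M F G β)
  minorBasis-exists F G with basisOf-exists F
  ... | I , basisI@(I⊆F , indI , _) with basisOf-extending (⊆-trans I⊆F (q⊆p∪q G F)) indI
  ...   | I' , I⊆I' , basisI' = I' ─ I , minorBasis
    where
    minorBasis : F ⊆ G → MinorBasis M F G (I' ─ I)
    minorBasis F⊆G = I'─I⊆G─F , I , basisI , subst (BasisOf M G) (sym [I'─I]∪I≡I') basisOfG
      where
      basisOfG : BasisOf M G I'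
      basisOfG = subst (λ Y → BasisOf M Y I') (⊆-antisym (∪-lub ⊆-refl F⊆G) (p⊆p∪q F)) basisI'
      [I'─I]∪I≡I' : (I' ─ I) ∪ I ≡ I'
      [I'─I]∪I≡I' = trans (∪-comm (I' ─ I) I) (q⊆p⇒q∪[p─q]≡p I⊆I')
      I'─I⊆G─F : I' ─ I ⊆ G ─ F
      I'─I⊆G─F z∈I'─I with x∈p─q⁻ I' I z∈I'─I
      ... | z∈I' , z∉I = x∈p∧x∉q⇒x∈p─q (proj₁ basisOfG z∈I') λ z∈F →
        z∉I (basisOf-absorbs basisI z∈F
               (indep-antimono (∪-lub I⊆I' (x∈p⇒⁅x⁆⊆p z∈I')) (proj₁ (proj₂ basisI'))))

  AdaptedBase : List (Subset n) → Subset n → Set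
  AdaptedBase 𝒮 B = B ∈ₗ bases M × (∀ G → G ∈ₗ 𝒮 → BasisOf M G (B ∩ G))

module Decomposition {n : ℕ} (M : Matroid n) (𝒮 : List (Subset n))
                     (𝒮-flat : ∀ {G} → G ∈ₗ 𝒮 → IsFlat M G) where

  open import Data.Nat using (_<_)
  open FiniteSets

  open MatroidTheory M

  𝒮⊤ : List (Subset n)
  𝒮⊤ = ⊤ ∷ 𝒮

  ∈𝒮⊤⇒isFlat : ∀ {G} → G ∈ₗ 𝒮⊤ → IsFlat M G
  ∈𝒮⊤⇒isFlat (here refl) = ⊤-isFlat
  ∈𝒮⊤⇒isFlat (there G∈𝒮) = 𝒮-flat G∈𝒮

  ∈strictlyBelow⁻ : ∀ {G H} → H ∈ₗ strictlyBelow M 𝒮 G → H ∈ₗ 𝒮 × H ⊆ G × H ≢ G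
  ∈strictlyBelow⁻ {G} = ∈-filter⁻ (λ H → (H ⊆? G) ×-dec ¬? (H ≟ˢ G)) {xs = 𝒮}

  ∈strictlyBelow⁺ : ∀ {G H} → H ∈ₗ 𝒮 → H ⊆ G → H ≢ G → H ∈ₗ strictlyBelow M 𝒮 G
  ∈strictlyBelow⁺ {G} H∈𝒮 H⊆G H≢G = ∈-filter⁺ (λ H → (H ⊆? G) ×-dec ¬? (H ≟ˢ G)) H∈𝒮 (H⊆G , H≢G)

  -- G< is ⊥, not cl ⊥, when nothing lies strictly below G; these two inclusions hold either way.
  ⋃strictlyBelow⊆G< : ∀ G → ⋃ (strictlyBelow M 𝒮 G) ⊆ G< M 𝒮 G
  ⋃strictlyBelow⊆G< G with strictlyBelow M 𝒮 G
  ... | []     = λ x∈⊥ → x∈⊥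
  ... | _ ∷ _  = X⊆clX

  G<⊆cl⋃strictlyBelow : ∀ G → G< M 𝒮 G ⊆ cl M (⋃ (strictlyBelow M 𝒮 G))
  G<⊆cl⋃strictlyBelow G with strictlyBelow M 𝒮 G
  ... | []     = λ x∈⊥ → X⊆clX x∈⊥
  ... | _ ∷ _  = λ x∈cl → x∈cl

  G<⊆G : ∀ {G} → IsFlat M G → G< M 𝒮 G ⊆ G
  G<⊆G {G} flatG = ⊆-trans (G<⊆cl⋃strictlyBelow G)
    (cl-least flatG (⋃-lub _ (λ H∈ → proj₁ (proj₂ (∈strictlyBelow⁻ H∈)))))

  ⋃bases-basisOf-G< : ∀ G (D : Subset n → Subset n) →
    (∀ {H} → H ∈ₗ strictlyBelow M 𝒮 G → BasisOf M H (D H)) →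
    Indep M (⋃ (map D (strictlyBelow M 𝒮 G))) →
    BasisOf M (G< M 𝒮 G) (⋃ (map D (strictlyBelow M 𝒮 G)))
  ⋃bases-basisOf-G< G D bases ind = spanning⇒basisOf ind
    (⋃map-lub D (strictlyBelow M 𝒮 G) λ H∈ →
      ⊆-trans (proj₁ (bases H∈)) (⊆-trans (p∈ps⇒p⊆⋃ps H∈) (⋃strictlyBelow⊆G< G)))
    (⊆-trans (G<⊆cl⋃strictlyBelow G) (cl-least (cl-isFlat _) (⋃-lub _ λ H∈ →
      ⊆-trans (basisOf⇒spanning (bases H∈)) (cl-mono (a∈as⇒fa⊆⋃map D H∈)))))

  sumBasis-exists : ∃[ B ] SumBasis M 𝒮 B
  sumBasis-exists = ⋃ (map β 𝒮⊤) , β , minorBases , refl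
    where
    β : Subset n → Subset n
    β G = proj₁ (minorBasis-exists (G< M 𝒮 G) G)
    minorBases : ∀ G → G ∈ₗ 𝒮⊤ → MinorBasis M (G< M 𝒮 G) G (β G)
    minorBases G G∈ = proj₂ (minorBasis-exists (G< M 𝒮 G) G) (G<⊆G (∈𝒮⊤⇒isFlat G∈))

  module _ {B} (adapted : AdaptedBase 𝒮 B) where

    private
      b = proj₁ adapted
      B∩G-basisOf = proj₂ adapted
      indB = base⇒indep b
      β : Subset n → Subset n
      β G = B ∩ (G ─ G< M 𝒮 G)
      V : Subset n → Subset n
      V G = ⋃ (map (B ∩_) (strictlyBelow M 𝒮 G))
      V⊆B : ∀ G → V G ⊆ B
      V⊆B G = ⋃map-lub (B ∩_) (strictlyBelow M 𝒮 G) (λ _ → p∩q⊆p B _)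

    B∩G-basisOf⁺ : ∀ {G} → G ∈ₗ 𝒮⊤ → BasisOf M G (B ∩ G)
    B∩G-basisOf⁺ (here refl) =
      subst (BasisOf M ⊤) (sym (∩-identityʳ B)) (Equivalence.to base⇔basisOf⊤ b)
    B∩G-basisOf⁺ (there G∈𝒮) = B∩G-basisOf _ G∈𝒮

    V-basisOf-G< : ∀ G → BasisOf M (G< M 𝒮 G) (V G)
    V-basisOf-G< G = ⋃bases-basisOf-G< G (B ∩_)
      (λ H∈ → B∩G-basisOf _ (proj₁ (∈strictlyBelow⁻ H∈))) (indep-antimono (V⊆B G) indB)

    B∩G<≡V : ∀ G → B ∩ G< M 𝒮 G ≡ V G
    B∩G<≡V G = maximal (B ∩ G< M 𝒮 G) (λ x∈V → x∈p∩q⁺ (V⊆B G x∈V , V⊆G< x∈V))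
                       (p∩q⊆q B _) (indep-antimono (p∩q⊆p B _) indB)
      where
      V⊆G< = proj₁ (V-basisOf-G< G)
      maximal = proj₂ (proj₂ (V-basisOf-G< G))

    B⊆⋃β : B ⊆ ⋃ (map β 𝒮⊤)
    B⊆⋃β {x} x∈B = descend ⊤ (<-wellFounded _) (here refl) ∈⊤
      where
      descend : ∀ G → Acc _<_ ∣ G ∣ → G ∈ₗ 𝒮⊤ → x ∈ G → x ∈ ⋃ (map β 𝒮⊤)
      descend G (acc rec) G∈ x∈G with x ∈? G< M 𝒮 G
      ... | no x∉G< = a∈as⇒fa⊆⋃map β G∈ (x∈p∩q⁺ (x∈B , x∈p∧x∉q⇒x∈p─q x∈G x∉G<))
      ... | yes x∈G< with x∈⋃map⁻ (B ∩_) _ (subst (x ∈_) (B∩G<≡V G) (x∈p∩q⁺ (x∈B , x∈G<)))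
      ...   | H , H∈ , x∈B∩H with ∈strictlyBelow⁻ H∈
      ...     | H∈𝒮 , H⊆G , H≢G =
        descend H (rec (p⊆q∧p≢q⇒∣p∣<∣q∣ H⊆G H≢G)) (there H∈𝒮) (p∩q⊆q B H x∈B∩H)

    adapted⇒sumBasis : SumBasis M 𝒮 B
    adapted⇒sumBasis = β , minorBases , ⊆-antisym B⊆⋃β (⋃map-lub β 𝒮⊤ (λ _ → p∩q⊆p B _))
      where
      minorBases : ∀ G → G ∈ₗ 𝒮⊤ → MinorBasis M (G< M 𝒮 G) G (β G)
      minorBases G G∈ = p∩q⊆q B _ , B ∩ G< M 𝒮 G ,
        subst (BasisOf M (G< M 𝒮 G)) (sym (B∩G<≡V G)) (V-basisOf-G< G) ,
        subst (BasisOf M G) (sym (r⊆q⇒[p∩[q─r]]∪[p∩r]≡p∩q (G<⊆G (∈𝒮⊤⇒isFlat G∈))))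
              (B∩G-basisOf⁺ G∈)

module BuildingSetTheory {n : ℕ} (M : Matroid n) (𝒢 : List (Subset n))
                         (building : IsBuildingSet M 𝒢) where

  open import Data.Nat using (_<_; _∸_)
  open FiniteSets

  open MatroidTheory M

  ∈𝒢⇒isFlat : ∀ {G} → G ∈ₗ 𝒢 → IsFlat M G
  ∈𝒢⇒isFlat G∈𝒢 = proj₁ (All.lookup (proj₁ building) G∈𝒢)

  ∈𝒢⇒nonempty : ∀ {G} → G ∈ₗ 𝒢 → Nonempty M G
  ∈𝒢⇒nonempty G∈𝒢 = proj₂ (All.lookup (proj₁ building) G∈𝒢)

  factor : ∀ X → Fin (length (maxBelow M 𝒢 X)) → Subset n
  factor X = lookup (maxBelow M 𝒢 X)

  private
    StrictlyAbove : Subset n → Subset n → Subset n → Set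
    StrictlyAbove X G H = H ⊆ X × G ⊆ H × G ≢ H

    StrictlyAbove? : ∀ X G H → Dec (StrictlyAbove X G H)
    StrictlyAbove? X G H = (H ⊆? X) ×-dec (G ⊆? H) ×-dec ¬? (G ≟ˢ H)

    MaximalBelow? : ∀ X G → Dec (G ⊆ X × ¬ Any (StrictlyAbove X G) 𝒢)
    MaximalBelow? X G = (G ⊆? X) ×-dec ¬? (any? (StrictlyAbove? X G) 𝒢)

  factor∈𝒢 : ∀ X j → factor X j ∈ₗ 𝒢
  factor∈𝒢 X j = proj₁ (∈-filter⁻ (MaximalBelow? X) {xs = 𝒢} (∈-lookup j))

  factor⊆ : ∀ X j → factor X j ⊆ X
  factor⊆ X j = proj₁ (proj₂ (∈-filter⁻ (MaximalBelow? X) {xs = 𝒢} (∈-lookup j)))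

  ⊆factor : ∀ X {G} → G ∈ₗ 𝒢 → G ⊆ X → ∃[ j ] (G ⊆ factor X j)
  ⊆factor X {G₀} G₀∈𝒢 G₀⊆X = climb G₀ (<-wellFounded _) G₀∈𝒢 G₀⊆X ⊆-refl
    where
    climb : ∀ G → Acc _<_ (n ∸ ∣ G ∣) → G ∈ₗ 𝒢 → G ⊆ X → G₀ ⊆ G → ∃[ j ] (G₀ ⊆ factor X j)
    climb G (acc rec) G∈𝒢 G⊆X G₀⊆G = step (any? (StrictlyAbove? X G) 𝒢)
      where
      step : Dec (Any (StrictlyAbove X G) 𝒢) → ∃[ j ] (G₀ ⊆ factor X j)
      step (no maximal) =
        let G∈max = ∈-filter⁺ (MaximalBelow? X) G∈𝒢 (G⊆X , maximal)
        in Any.index G∈max , subst (G₀ ⊆_) (lookup-index G∈max) G₀⊆G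
      step (yes above) with find above
      ... | H , H∈𝒢 , H⊆X , G⊆H , G≢H =
        climb H (rec (ℕP.∸-monoʳ-< (p⊆q∧p≢q⇒∣p∣<∣q∣ G⊆H G≢H) (∣p∣≤n H))) H∈𝒢 H⊆X (⊆-trans G₀⊆G G⊆H)

  -- A dependency x ∈ cl (U - x) makes the families cl (J j) and cl (J j - x) have the same join,
  -- so the order isomorphism forces cl (J j) ⊆ cl (J j - x) for the j with x ∈ J j.
  factorwise-indep⇒indep : ∀ X → IsFlat M X → Nonempty M X →
    (J : Fin (length (maxBelow M 𝒢 X)) → Subset n) → (∀ j → J j ⊆ factor X j) →
    (∀ j → Indep M (J j)) → Indep M (⋃ (map J (allFin _)))
  factorwise-indep⇒indep X flatX neX J J⊆factor indJ =
    decidable-stable (indep? M U) (λ depU → no-dependency (dep⇒∃∈cl[-] depU))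
    where
    k = length (maxBelow M 𝒢 X)
    U = ⋃ (map J (allFin k))
    orderEmbedding = proj₁ (proj₂ (proj₂ building X flatX neX))

    no-dependency : ¬ (∃[ x ] (x ∈ U × x ∈ cl M (U - x)))
    no-dependency (x , x∈U , x∈cl[U-x]) =
      let (a , _ , x∈Ja) = x∈⋃map⁻ J (allFin k) x∈U
      in indep⇒∉cl[-] (indJ a) x∈Ja (t⊆s a (X⊆clX x∈Ja))
      where
      t s : Fin k → Subset n
      t j = cl M (J j)
      s j = cl M (J j - x)
      U-x⊆⋃s : U - x ⊆ ⋃ (map s (allFin k))
      U-x⊆⋃s v∈U-x =
        let (v∈U , v∉⁅x⁆) = x∈p─q⁻ U ⁅ x ⁆ v∈U-x
            (j , j∈ , v∈Jj) = x∈⋃map⁻ J (allFin k) v∈U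
        in a∈as⇒fa⊆⋃map s j∈ (X⊆clX (x∈p∧x∉q⇒x∈p─q v∈Jj v∉⁅x⁆))
      U⊆cl⋃s : U ⊆ cl M (⋃ (map s (allFin k)))
      U⊆cl⋃s {w} w∈U = by-cases (w FinP.≟ x)
        where
        by-cases : Dec (w ≡ x) → w ∈ cl M (⋃ (map s (allFin k)))
        by-cases (yes refl) = cl-mono U-x⊆⋃s x∈cl[U-x]
        by-cases (no w≢x) = X⊆clX (U-x⊆⋃s (x∈p∧x≢y⇒x∈p-y w∈U w≢x))
      φt⊆φs : join M (map t (allFin k)) ⊆ join M (map s (allFin k))
      φt⊆φs = ⊆-trans
        (cl-least (cl-isFlat U) (⋃map-lub t (allFin k) (λ j∈ → cl-mono (a∈as⇒fa⊆⋃map J j∈))))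
        (cl-least (cl-isFlat _) U⊆cl⋃s)
      t⊆s : ∀ j → t j ⊆ s j
      t⊆s = proj₂ (orderEmbedding t s
        (λ j → cl-isFlat (J j) , cl-least (∈𝒢⇒isFlat (factor∈𝒢 X j)) (J⊆factor j))
        (λ j → cl-isFlat (J j - x) ,
               cl-least (∈𝒢⇒isFlat (factor∈𝒢 X j)) (⊆-trans (p─q⊆p (J j) _) (J⊆factor j))))
        φt⊆φs

  join∉𝒢⇒¬All⊆factor : ∀ (L : List (Subset n)) → join M L ∉ₗ 𝒢 →
                        ∀ j → ¬ All (_⊆ factor (join M L) j) L
  join∉𝒢⇒¬All⊆factor L X∉𝒢 j L⊆factor = X∉𝒢 (subst (_∈ₗ 𝒢) factor≡X (factor∈𝒢 X j))
    where
    X = join M L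
    factor≡X : factor X j ≡ X
    factor≡X = ⊆-antisym (factor⊆ X j)
      (cl-least (∈𝒢⇒isFlat (factor∈𝒢 X j)) (⋃-lub L (All.lookup L⊆factor)))

module NestedSetTheory {n : ℕ} (M : Matroid n) (𝒢 : List (Subset n)) (building : IsBuildingSet M 𝒢)
                       (𝒮 : List (Subset n)) (nested : IsNested M 𝒢 𝒮) where

  open import Data.Nat using (_<_)
  open FiniteSets

  open MatroidTheory M
  open BuildingSetTheory M 𝒢 building

  ∈𝒮⇒∈𝒢 : ∀ {G} → G ∈ₗ 𝒮 → G ∈ₗ 𝒢
  ∈𝒮⇒∈𝒢 = All.lookup (proj₁ nested)

  NestedBasis : (Subset n → Subset n) → Subset n → Set
  NestedBasis D H = H ∈ₗ 𝒮 × BasisOf M H (D H)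

  IndepOnShorter : (Subset n → Subset n) → List (Subset n) → Set
  IndepOnShorter D L = ∀ L' → length L' < length L → All (NestedBasis D) L' → Indep M (⋃ (map D L'))

  shorterCover-step : ∀ D → (∀ {H H'} → H ⊆ H' → D H ⊆ D H') → ∀ L → ShorterCover L →
                      IndepOnShorter D L → All (NestedBasis D) L → Indep M (⋃ (map D L))
  shorterCover-step D D-mono L (L' , shorter , L'⊆L , dominated) ih bases =
    indep-antimono (⋃map-lub D L covered) (ih L' shorter (All.tabulate (All.lookup bases ∘ L'⊆L)))
    where
    covered : ∀ {H} → H ∈ₗ L → D H ⊆ ⋃ (map D L')
    covered H∈L =
      let (H' , H'∈L' , H⊆H') = dominated H∈L in ⊆-trans (D-mono H⊆H') (a∈as⇒fa⊆⋃map D H'∈L')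

  -- The join X of a nested antichain of two or more sets lies outside 𝒢, so no factor of X
  -- contains the whole antichain and grouping it by factors yields shorter lists.
  antichain-step : ∀ D L → AllPairs (Incomparable M) L →
                   IndepOnShorter D L → All (NestedBasis D) L → Indep M (⋃ (map D L))
  antichain-step D [] _ _ _ = indep-⊥
  antichain-step D (_ ∷ []) _ _ ((_ , _ , indH , _) ∷ []) =
    indep-antimono (∪-lub ⊆-refl (⊆-min _)) indH
  antichain-step D L@(H ∷ _ ∷ _) antichain ih bases =
    indep-antimono covered (factorwise-indep⇒indep X (cl-isFlat _) neX J J⊆factor indJ)
    where
    X = join M L
    X∉𝒢 : X ∉ₗ 𝒢
    X∉𝒢 = proj₂ nested L (s≤s (s≤s z≤n)) (All.map proj₁ bases) antichain
    neX : Nonempty M X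
    neX = let (i , i∈H) = ∈𝒢⇒nonempty (∈𝒮⇒∈𝒢 (proj₁ (All.head bases))) in i , X⊆clX (p⊆p∪q _ i∈H)
    k = length (maxBelow M 𝒢 X)
    group : Fin k → List (Subset n)
    group j = filter (_⊆? factor X j) L
    J : Fin k → Subset n
    J j = ⋃ (map D (group j))
    J⊆factor : ∀ j → J j ⊆ factor X j
    J⊆factor j = ⋃map-lub D (group j) λ H∈group →
      let (H∈L , H⊆factor) = ∈-filter⁻ (_⊆? factor X j) {xs = L} H∈group
      in ⊆-trans (proj₁ (proj₂ (All.lookup bases H∈L))) H⊆factor
    indJ : ∀ j → Indep M (J j)
    indJ j = ih (group j)
      (filter-notAll (_⊆? factor X j) L (¬All⇒Any¬ (_⊆? factor X j) L (join∉𝒢⇒¬All⊆factor L X∉𝒢 j)))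
      (filter⁺ (_⊆? factor X j) bases)
    covered : ⋃ (map D L) ⊆ ⋃ (map J (allFin k))
    covered = ⋃map-lub D L λ H∈L →
      let (j , H⊆factor) = ⊆factor X (∈𝒮⇒∈𝒢 (proj₁ (All.lookup bases H∈L)))
                                     (⊆-trans (p∈ps⇒p⊆⋃ps H∈L) X⊆clX)
      in ⊆-trans (a∈as⇒fa⊆⋃map D (∈-filter⁺ (_⊆? factor X j) H∈L H⊆factor))
                 (a∈as⇒fa⊆⋃map J (∈-allFin j))

  ⋃-nestedBases-indep : ∀ (D : Subset n → Subset n) → (∀ {H H'} → H ⊆ H' → D H ⊆ D H') →
                        ∀ L → All (NestedBasis D) L → Indep M (⋃ (map D L))
  ⋃-nestedBases-indep D D-mono L = go L (<-wellFounded _)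
    where
    go : ∀ L → Acc _<_ (length L) → All (NestedBasis D) L → Indep M (⋃ (map D L))
    go L (acc rec) = Sum.[ antichain-step D L , shorterCover-step D D-mono L ]′
                       (antichain⊎shorterCover L) (λ L' shorter → go L' (rec shorter))

  open Decomposition M 𝒮 (∈𝒢⇒isFlat ∘ ∈𝒮⇒∈𝒢) public

  module SumOfMinorBases {β : Subset n → Subset n}
                         (minorBases : ∀ G → G ∈ₗ 𝒮⊤ → MinorBasis M (G< M 𝒮 G) G (β G)) where

    downset : Subset n → List (Subset n)
    downset G = filter (_⊆? G) 𝒮⊤

    βdown : Subset n → Subset n
    βdown G = ⋃ (map β (downset G))

    βdown-mono : ∀ {H H'} → H ⊆ H' → βdown H ⊆ βdown H'
    βdown-mono {H} {H'} H⊆H' = ⋃map-lub β (downset H) λ G∈ →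
      let (G∈𝒮⊤ , G⊆H) = ∈-filter⁻ (_⊆? H) {xs = 𝒮⊤} G∈
      in a∈as⇒fa⊆⋃map β (∈-filter⁺ (_⊆? H') G∈𝒮⊤ (⊆-trans G⊆H H⊆H'))

    βdown≡β∪⋃βdown : ∀ {G} → G ∈ₗ 𝒮⊤ → βdown G ≡ β G ∪ ⋃ (map βdown (strictlyBelow M 𝒮 G))
    βdown≡β∪⋃βdown {G} G∈ = ⊆-antisym (⋃map-lub β (downset G) split) (∪-lub βG⊆ ⋃⊆)
      where
      βG⊆ : β G ⊆ βdown G
      βG⊆ = a∈as⇒fa⊆⋃map β (∈-filter⁺ (_⊆? G) G∈ ⊆-refl)
      ⋃⊆ : ⋃ (map βdown (strictlyBelow M 𝒮 G)) ⊆ βdown G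
      ⋃⊆ = ⋃map-lub βdown _ (λ H∈ → βdown-mono (proj₁ (proj₂ (∈strictlyBelow⁻ H∈))))
      RHS = β G ∪ ⋃ (map βdown (strictlyBelow M 𝒮 G))
      split : ∀ {G'} → G' ∈ₗ downset G → β G' ⊆ RHS
      split {G'} G'∈ = by-cases (∈-filter⁻ (_⊆? G) {xs = 𝒮⊤} G'∈) (G' ≟ˢ G)
        where
        by-cases : G' ∈ₗ 𝒮⊤ × G' ⊆ G → Dec (G' ≡ G) → β G' ⊆ RHS
        by-cases _ (yes refl) = p⊆p∪q _
        by-cases (here refl , ⊤⊆G) (no ⊤≢G) = ⊥-elim (⊤≢G (⊆-antisym ⊤⊆G ⊆⊤))
        by-cases (there G'∈𝒮 , G'⊆G) (no G'≢G) = ⊆-trans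
          (a∈as⇒fa⊆⋃map β (∈-filter⁺ (_⊆? G') {xs = 𝒮⊤} (there G'∈𝒮) ⊆-refl))
          (⊆-trans (a∈as⇒fa⊆⋃map βdown (∈strictlyBelow⁺ G'∈𝒮 G'⊆G G'≢G)) (q⊆p∪q _ _))

    -- The bases βdown H for H strictly below G combine into a basis of G< by nestedness, which
    -- can replace the basis of G< relative to which β G is a basis of the minor.
    βdown-basisOf : ∀ G → G ∈ₗ 𝒮⊤ → BasisOf M G (βdown G)
    βdown-basisOf G = go G (<-wellFounded _)
      where
      go : ∀ G → Acc _<_ ∣ G ∣ → G ∈ₗ 𝒮⊤ → BasisOf M G (βdown G)
      go G (acc rec) G∈ =
        let (βG⊆G─G< , _ , basisI , basisβG∪I) = minorBases G G∈
        in subst (BasisOf M G) (sym (βdown≡β∪⋃βdown G∈))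
             (basisOf-contraction-invariant (G<⊆G (∈𝒮⊤⇒isFlat G∈)) basisI basisU βG⊆G─G< basisβG∪I)
        where
        L = strictlyBelow M 𝒮 G
        nestedBases : All (NestedBasis βdown) L
        nestedBases = All.tabulate λ {H} H∈ →
          let (H∈𝒮 , H⊆G , H≢G) = ∈strictlyBelow⁻ H∈
          in H∈𝒮 , go H (rec (p⊆q∧p≢q⇒∣p∣<∣q∣ H⊆G H≢G)) (there H∈𝒮)
        basisU : BasisOf M (G< M 𝒮 G) (⋃ (map βdown L))
        basisU = ⋃bases-basisOf-G< G βdown (proj₂ ∘ All.lookup nestedBases)
                   (⋃-nestedBases-indep βdown βdown-mono L nestedBases)

  sumBasis⇒adapted : ∀ {B} → SumBasis M 𝒮 B → AdaptedBase 𝒮 B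
  sumBasis⇒adapted {B} (β , minorBases , B≡⋃β) = Equivalence.from base⇔basisOf⊤ basisB , B∩G-basisOf
    where
    open SumOfMinorBases minorBases
    B≡βdown⊤ : B ≡ βdown ⊤
    B≡βdown⊤ = trans B≡⋃β (cong (⋃ ∘ map β) (sym (filter-all (_⊆? ⊤) (All.tabulate (λ _ → ⊆⊤)))))
    basisB : BasisOf M ⊤ B
    basisB = subst (BasisOf M ⊤) (sym B≡βdown⊤) (βdown-basisOf ⊤ (here refl))
    B∩G-basisOf : ∀ G → G ∈ₗ 𝒮 → BasisOf M G (B ∩ G)
    B∩G-basisOf G G∈𝒮 = subst (BasisOf M G) (sym B∩G≡βdownG) basisG
      where
      basisG = βdown-basisOf G (there G∈𝒮)
      βdownG⊆B∩G : βdown G ⊆ B ∩ G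
      βdownG⊆B∩G x∈ = x∈p∩q⁺ (subst (_ ∈_) (sym B≡βdown⊤) (βdown-mono ⊆⊤ x∈) , proj₁ basisG x∈)
      B∩G≡βdownG = proj₂ (proj₂ basisG) (B ∩ G) βdownG⊆B∩G (p∩q⊆q B G)
                      (indep-antimono (p∩q⊆p B G) (proj₁ (proj₂ basisB)))

  adaptedBase-exists : ∃[ B ] AdaptedBase 𝒮 B
  adaptedBase-exists = let (B , sumBasis) = sumBasis-exists in B , sumBasis⇒adapted sumBasis

module Weights where

  open import Algebra.Bundles using (CommutativeMonoid)
  open import Data.Rational as ℚ using (ℚ; 0ℚ; _+_; _≤_; _<_)
  import Data.Rational.Properties as ℚP
  open import Algebra.Definitions.RawMonoid ℚ.+-0-rawMonoid public using () renaming (_×_ to _·_)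
  open import Algebra.Properties.CommutativeSemigroup
    (CommutativeMonoid.commutativeSemigroup ℚP.+-0-commutativeMonoid) using (interchange)
  open FiniteSets

  private variable
    n : ℕ
    A B : Set

  sumℚ : List ℚ → ℚ
  sumℚ = foldr _+_ 0ℚ

  sumℚ-0 : ∀ (xs : List A) → sumℚ (map (λ _ → 0ℚ) xs) ≡ 0ℚ
  sumℚ-0 []       = refl
  sumℚ-0 (_ ∷ xs) = trans (ℚP.+-identityˡ _) (sumℚ-0 xs)

  sumℚ-+ : ∀ (f g : A → ℚ) xs → sumℚ (map (λ x → f x + g x) xs) ≡ sumℚ (map f xs) + sumℚ (map g xs)
  sumℚ-+ f g []       = sym (ℚP.+-identityˡ 0ℚ)
  sumℚ-+ f g (x ∷ xs) = trans (cong (f x + g x +_) (sumℚ-+ f g xs)) (interchange (f x) (g x) _ _)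

  sumℚ-swap : ∀ (h : A → B → ℚ) xs ys →
    sumℚ (map (λ x → sumℚ (map (h x) ys)) xs) ≡ sumℚ (map (λ y → sumℚ (map (λ x → h x y) xs)) ys)
  sumℚ-swap h []       ys = sym (sumℚ-0 ys)
  sumℚ-swap h (x ∷ xs) ys = trans (cong (sumℚ (map (h x) ys) +_) (sumℚ-swap h xs ys))
                                  (sym (sumℚ-+ (h x) (λ y → sumℚ (map (λ x → h x y) xs)) ys))

  sumℚ-allFin-suc : ∀ (f : Fin (suc n) → ℚ) →
    sumℚ (map f (allFin (suc n))) ≡ f zero + sumℚ (map (f ∘ suc) (allFin n))
  sumℚ-allFin-suc f = cong (λ xs → f zero + sumℚ xs)
    (trans (map-tabulate suc f) (sym (map-tabulate id (f ∘ suc))))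

  if-sumℚ : ∀ b (g : A → ℚ) xs →
    (if b then sumℚ (map g xs) else 0ℚ) ≡ sumℚ (map (λ x → if b then g x else 0ℚ) xs)
  if-sumℚ true  g xs = refl
  if-sumℚ false g xs = sym (sumℚ-0 xs)

  -- ⌊_⌋ is stuck on the Dec.map′ in the definition of _∈?_, whereas does computes through it.
  ⌊suc∈?∷⌋ : ∀ b (p : Subset n) i → ⌊ suc i ∈? (b ∷ p) ⌋ ≡ ⌊ i ∈? p ⌋
  ⌊suc∈?∷⌋ b p i = trans (isYes≗does (suc i ∈? (b ∷ p))) (sym (isYes≗does (i ∈? p)))

  indicator : Subset n → ℚ → Fin n → ℚ
  indicator p q i = if ⌊ i ∈? p ⌋ then q else 0ℚ

  sumℚ-indicator : ∀ (p : Subset n) q → sumℚ (map (indicator p q) (allFin n)) ≡ ∣ p ∣ · q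
  sumℚ-indicator-suc : ∀ b (p : Subset n) q →
    sumℚ (map (indicator (b ∷ p) q ∘ suc) (allFin n)) ≡ ∣ p ∣ · q

  sumℚ-indicator []          q = refl
  sumℚ-indicator (true ∷ p)  q =
    trans (sumℚ-allFin-suc (indicator (true ∷ p) q)) (cong (q +_) (sumℚ-indicator-suc true p q))
  sumℚ-indicator (false ∷ p) q =
    trans (sumℚ-allFin-suc (indicator (false ∷ p) q))
          (trans (ℚP.+-identityˡ _) (sumℚ-indicator-suc false p q))

  sumℚ-indicator-suc b p q = trans
    (cong sumℚ (map-cong (λ i → cong (if_then q else 0ℚ) (⌊suc∈?∷⌋ b p i)) (allFin _)))
    (sumℚ-indicator p q)

  indicator-∩ : ∀ (p r : Subset n) q i → indicator p (indicator r q i) i ≡ indicator (p ∩ r) q i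
  indicator-∩ p r q i with i ∈? p | i ∈? r | i ∈? p ∩ r
  ... | yes _   | yes _   | yes _     = refl
  ... | yes i∈p | yes i∈r | no i∉p∩r  = ⊥-elim (i∉p∩r (x∈p∩q⁺ (i∈p , i∈r)))
  ... | yes _   | no i∉r  | yes i∈p∩r = ⊥-elim (i∉r (proj₂ (x∈p∩q⁻ p r i∈p∩r)))
  ... | yes _   | no _    | no _      = refl
  ... | no i∉p  | _       | yes i∈p∩r = ⊥-elim (i∉p (proj₁ (x∈p∩q⁻ p r i∈p∩r)))
  ... | no _    | _       | no _      = refl

  weight≡sumℚ∣∩∣· : ∀ (M : Matroid n) 𝒮 (λG : Subset n → ℚ) τ →
    weight M (weightVector 𝒮 λG) τ ≡ sumℚ (map (λ G → ∣ τ ∩ G ∣ · λG G) 𝒮)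
  weight≡sumℚ∣∩∣· {n} M 𝒮 λG τ = begin
    weight M (weightVector 𝒮 λG) τ
      ≡⟨ cong sumℚ (map-cong (λ i → if-sumℚ ⌊ i ∈? τ ⌋ (λ G → indicator G (λG G) i) 𝒮) (allFin n)) ⟩
    sumℚ (map (λ i → sumℚ (map (h i) 𝒮)) (allFin n))
      ≡⟨ sumℚ-swap h (allFin n) 𝒮 ⟩
    sumℚ (map (λ G → sumℚ (map (λ i → h i G) (allFin n))) 𝒮)
      ≡⟨ cong sumℚ (map-cong count 𝒮) ⟩
    sumℚ (map (λ G → ∣ τ ∩ G ∣ · λG G) 𝒮) ∎
    where
    open ≡-Reasoning
    h : Fin n → Subset n → ℚ
    h i G = indicator τ (indicator G (λG G) i) i
    count : ∀ G → sumℚ (map (λ i → h i G) (allFin n)) ≡ ∣ τ ∩ G ∣ · λG G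
    count G = trans (cong sumℚ (map-cong (indicator-∩ τ G (λG G)) (allFin n)))
                    (sumℚ-indicator (τ ∩ G) (λG G))

  ·-nonneg : ∀ k {q} → 0ℚ ≤ q → 0ℚ ≤ k · q
  ·-nonneg zero    _   = ℚP.≤-refl
  ·-nonneg (suc k) {q} 0≤q =
    subst (_≤ q + k · q) (ℚP.+-identityˡ 0ℚ) (ℚP.+-mono-≤ 0≤q (·-nonneg k 0≤q))

  ·-monoˡ-≤ : ∀ {a b q} → a ℕ.≤ b → 0ℚ ≤ q → a · q ≤ b · q
  ·-monoˡ-≤ {b = b} z≤n       0≤q = ·-nonneg b 0≤q
  ·-monoˡ-≤ {q = q} (s≤s a≤b) 0≤q = ℚP.+-monoʳ-≤ q (·-monoˡ-≤ a≤b 0≤q)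

  ·-monoˡ-< : ∀ {a b q} → a ℕ.< b → 0ℚ < q → a · q < b · q
  ·-monoˡ-< {zero}  {suc b} {q} _ 0<q =
    subst (_< q + b · q) (ℚP.+-identityˡ 0ℚ) (ℚP.+-mono-<-≤ 0<q (·-nonneg b (ℚP.<⇒≤ 0<q)))
  ·-monoˡ-< {suc a} {suc b} {q} (s≤s a<b) 0<q = ℚP.+-monoʳ-< q (·-monoˡ-< a<b 0<q)

  sumℚ-mono-≤ : ∀ {f g : A → ℚ} {xs} → All (λ x → f x ≤ g x) xs → sumℚ (map f xs) ≤ sumℚ (map g xs)
  sumℚ-mono-≤ []           = ℚP.≤-refl
  sumℚ-mono-≤ (fx≤gx ∷ fs≤gs) = ℚP.+-mono-≤ fx≤gx (sumℚ-mono-≤ fs≤gs)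

  sumℚ-mono-< : ∀ {f g : A → ℚ} {xs} → All (λ x → f x ≤ g x) xs → Any (λ x → f x < g x) xs →
                sumℚ (map f xs) < sumℚ (map g xs)
  sumℚ-mono-< (_ ∷ fs≤gs)     (here fx<gx) = ℚP.+-mono-<-≤ fx<gx (sumℚ-mono-≤ fs≤gs)
  sumℚ-mono-< (fx≤gx ∷ fs≤gs) (there f<g)  = ℚP.+-mono-≤-< fx≤gx (sumℚ-mono-< fs≤gs f<g)

open import Data.List.Relation.Unary.Unique.Propositional using (Unique)
open import Data.Rational using (ℚ; 0ℚ; _<_)
import Function.Properties.Equivalence as ⇔

module MaxWeight {n : ℕ} (M : Matroid n) (𝒮 : List (Subset n)) (λG : Subset n → ℚ)
                 (λG>0 : ∀ G → G ∈ₗ 𝒮 → 0ℚ < λG G) where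

  open import Data.Rational using (_≤_)
  import Data.Rational.Properties as ℚP
  open MatroidTheory M
  open Weights

  private
    w = weightVector 𝒮 λG

  rankWeight : ℚ
  rankWeight = sumℚ (map (λ G → rank M G · λG G) 𝒮)

  ∣∩∣·λ≤rank·λ : ∀ {B} → B ∈ₗ bases M → All (λ G → ∣ B ∩ G ∣ · λG G ≤ rank M G · λG G) 𝒮
  ∣∩∣·λ≤rank·λ {B} b = All.tabulate λ {G} G∈ → ·-monoˡ-≤
    (∣indep∣≤rank (p∩q⊆q B G) (indep-antimono (p∩q⊆p B G) (base⇒indep b))) (ℚP.<⇒≤ (λG>0 G G∈))

  weight≤rankWeight : ∀ {B} → B ∈ₗ bases M → weight M w B ≤ rankWeight
  weight≤rankWeight {B} b =
    subst (_≤ rankWeight) (sym (weight≡sumℚ∣∩∣· M 𝒮 λG B)) (sumℚ-mono-≤ (∣∩∣·λ≤rank·λ b))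

  weight<rankWeight : ∀ {B G} → B ∈ₗ bases M → G ∈ₗ 𝒮 → ∣ B ∩ G ∣ ℕ.< rank M G →
                      weight M w B < rankWeight
  weight<rankWeight {B} {G} b G∈ deficient = subst (_< rankWeight) (sym (weight≡sumℚ∣∩∣· M 𝒮 λG B))
    (sumℚ-mono-< (∣∩∣·λ≤rank·λ b) (lose G∈ (·-monoˡ-< deficient (λG>0 G G∈))))

  adapted⇒weight≡rankWeight : ∀ {B} → AdaptedBase 𝒮 B → weight M w B ≡ rankWeight
  adapted⇒weight≡rankWeight {B} (_ , B∩G-basisOf) = trans (weight≡sumℚ∣∩∣· M 𝒮 λG B)
    (cong sumℚ (map-cong-local (All.tabulate λ {G} G∈ →
      cong (_· λG G) (sym (rank≡∣basisOf∣ (B∩G-basisOf G G∈))))))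

  maxWeight⇔adapted : ∃[ B₀ ] AdaptedBase 𝒮 B₀ → ∀ {B} → BasisW M w B ⇔ AdaptedBase 𝒮 B
  maxWeight⇔adapted (B₀ , adapted₀) {B} = mk⇔ maxWeight⇒adapted adapted⇒maxWeight
    where
    adapted⇒maxWeight : AdaptedBase 𝒮 B → BasisW M w B
    adapted⇒maxWeight adapted = proj₁ adapted , λ σ σ∈ →
      subst (weight M w σ ≤_) (sym (adapted⇒weight≡rankWeight adapted)) (weight≤rankWeight σ∈)
    maxWeight⇒adapted : BasisW M w B → AdaptedBase 𝒮 B
    maxWeight⇒adapted (b , maximal) = b , λ G G∈ →
      rank≤∣indep∣⇒basisOf (p∩q⊆q B G) (indep-antimono (p∩q⊆p B G) (base⇒indep b)) (full G∈)
      where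
      rankWeight≤weight : rankWeight ≤ weight M w B
      rankWeight≤weight =
        subst (_≤ weight M w B) (adapted⇒weight≡rankWeight adapted₀) (maximal B₀ (proj₁ adapted₀))
      full : ∀ {G} → G ∈ₗ 𝒮 → rank M G ℕ.≤ ∣ B ∩ G ∣
      full {G} G∈ = decidable-stable (rank M G ℕ.≤? ∣ B ∩ G ∣) λ ¬full →
        ℚP.<-irrefl refl (ℚP.<-≤-trans (weight<rankWeight b G∈ (ℕP.≰⇒> ¬full)) rankWeight≤weight)

theorem4p4 : ∀ {n : ℕ} (M : Matroid n) → Connected M →
    (𝒢 : List (Subset n)) → IsBuildingSet M 𝒢 →
    (𝒮 : List (Subset n)) → Unique 𝒮 → IsNested M 𝒢 𝒮 → ⊤ ∉ₗ 𝒮 →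
    (λG : Subset n → ℚ) → (∀ G → G ∈ₗ 𝒮 → 0ℚ < λG G) →
    ∀ (B : Subset n) → BasisW M (weightVector 𝒮 λG) B ⇔ SumBasis M 𝒮 B
theorem4p4 M _ 𝒢 building 𝒮 _ nested _ λG λG>0 B =
  ⇔.trans (maxWeight⇔adapted adaptedBase-exists) (mk⇔ adapted⇒sumBasis sumBasis⇒adapted)
  where
  open NestedSetTheory M 𝒢 building 𝒮 nested
  open MaxWeight M 𝒮 λG λG>0
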